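{- Let $G$ be a graph with $n=|V(G)|\ge 2$ and let $P_r$ be the path on $r\ge 3$ vertices. Then: (1) $\mu_k(P_r\odot G)=(k-1)n+2$ for every integer $k$ with $2\le k\le r-1$; (2) $\mu_r(P_r\odot G)=(r-1)n+1$; (3) $\mu_{r+1}(P_r\odot G)=\mu(P_r\odot G)=rn$.
   Context: The corona graph $G\odot H$ is obtained from one copy of $G$ and $|V(G)|$ copies of $H$ by joining the $i$th vertex of $G$ to every vertex of the $i$th copy of $H$. For a graph $G$, a set $S\subseteq V(G)$ and an integer $k\ge 1$, two vertices $x,y$ are $S_k$-visible if there is a shortest $x,y$-path of length at most $k$ none of whose internal vertices lies in $S$. $S$ is a $k$-distance mutual-visibility set if every two vertices of $S$ are $S_k$-visible, and $\mu_k(G)$ is the maximum cardinality of such a set. Two vertices $x,y\in S$ are $S$-visible if there is a shortest $x,y$-path $P$ with $V(P)\cap S=\{x,y\}$; $\mu(G)$ is the maximum cardinality of a set $S$ in which every two vertices are $S$-visible. -}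

module Defs where

open import Data.Nat using (ℕ; zero; suc; _≤_)
open import Data.Nat.Properties using (1+n≢n)
open import Data.Fin using (Fin; toℕ)
open import Data.Sum using (_⊎_; inj₁; inj₂; swap)
open import Data.Product using (_×_; _,_; ∃; ∃-syntax; proj₁; proj₂)
open import Data.List using (List; []; _∷_; length)
open import Data.List.Relation.Unary.All using (All)
open import Data.List.Relation.Unary.Unique.Propositional using (Unique)
open import Data.List.Membership.Propositional using (_∈_; _∉_)
open import Relation.Nullary using (¬_; Dec; yes; no)
open import Relation.Nullary.Decidable using (_⊎-dec_; _×-dec_)
open import Relation.Binary.PropositionalEquality using (_≡_; refl; sym)
open import Data.Empty using (⊥)
open import Data.Unit using (⊤)

record Graph (V : Set) : Set₁ where
  field
    Adj    : V → V → Set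
    symm   : ∀ {x y} → Adj x y → Adj y x
    irrefl : ∀ {x} → ¬ Adj x x
    adj?   : ∀ x y → Dec (Adj x y)
open Graph public

pathGraph : (r : ℕ) → Graph (Fin r)
pathGraph r = record
  { Adj    = λ i j → (toℕ j ≡ suc (toℕ i)) ⊎ (toℕ i ≡ suc (toℕ j))
  ; symm   = swap
  ; irrefl = λ { {i} (inj₁ e) → 1+n≢n (sym e) ; {i} (inj₂ e) → 1+n≢n (sym e) }
  ; adj?   = λ i j → (toℕ j Data.Nat.≟ suc (toℕ i)) ⊎-dec (toℕ i Data.Nat.≟ suc (toℕ j))
  }
  where import Data.Nat

-- Corona G ⊙ H: vertices of G (inj₁ a) and, for each vertex a of G,
-- a copy of H (inj₂ (a , b)).  The a-th vertex of G is joined to every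
-- vertex of the a-th copy of H.
module _ {A B : Set} (G : Graph A) (H : Graph B) where
  CAdj : A ⊎ (A × B) → A ⊎ (A × B) → Set
  CAdj (inj₁ a) (inj₁ a')        = Adj G a a'
  CAdj (inj₁ a) (inj₂ (a' , _))  = a ≡ a'
  CAdj (inj₂ (a , _)) (inj₁ a')  = a ≡ a'
  CAdj (inj₂ (a , b)) (inj₂ (a' , b')) = (a ≡ a') × Adj H b b'

  csym : ∀ {x y} → CAdj x y → CAdj y x
  csym {inj₁ _} {inj₁ _} e = symm G e
  csym {inj₁ _} {inj₂ _} e = sym e
  csym {inj₂ _} {inj₁ _} e = sym e
  csym {inj₂ _} {inj₂ _} (e , h) = sym e , symm H h

  cirr : ∀ {x} → ¬ CAdj x x
  cirr {inj₁ _} e = irrefl G e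
  cirr {inj₂ _} (_ , h) = irrefl H h

  module _ (eqA? : ∀ (a a' : A) → Dec (a ≡ a')) where
    cdec : ∀ x y → Dec (CAdj x y)
    cdec (inj₁ a) (inj₁ a') = adj? G a a'
    cdec (inj₁ a) (inj₂ (a' , _)) = eqA? a a'
    cdec (inj₂ (a , _)) (inj₁ a') = eqA? a a'
    cdec (inj₂ (a , b)) (inj₂ (a' , b')) = eqA? a a' ×-dec adj? H b b'

    corona : Graph (A ⊎ (A × B))
    corona = record { Adj = CAdj ; symm = λ {x} {y} → csym {x} {y} ; irrefl = λ {x} → cirr {x} ; adj? = cdec }

pathCorona : (r : ℕ) {n : ℕ} → Graph (Fin n) → Graph (Fin r ⊎ (Fin r × Fin n))
pathCorona r G = corona (pathGraph r) G Data.Fin._≟_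
  where import Data.Fin

data Walk {V : Set} (G : Graph V) : V → V → Set where
  []  : ∀ {x} → Walk G x x
  _∷_ : ∀ {x y z} → Adj G x y → Walk G y z → Walk G x z

module _ {V : Set} {G : Graph V} where
  len : ∀ {x y} → Walk G x y → ℕ
  len []      = zero
  len (_ ∷ w) = suc (len w)

  inner : ∀ {x y} → Walk G x y → List V
  inner []                         = []
  inner (_ ∷ [])                   = []
  inner (_∷_ {y = y} _ (e ∷ w))    = y ∷ inner (e ∷ w)

IsShortest : ∀ {V} (G : Graph V) {x y : V} → Walk G x y → Set
IsShortest G {x} {y} w = ∀ (w' : Walk G x y) → len w ≤ len w'

SkVisible : ∀ {V} (G : Graph V) (S : List V) (k : ℕ) (x y : V) → Set
SkVisible G S k x y =
  ∃[ w ] (IsShortest G {x} {y} w × len w ≤ k × All (_∉ S) (inner w))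

SVisible : ∀ {V} (G : Graph V) (S : List V) (x y : V) → Set
SVisible G S x y =
  ∃[ w ] (IsShortest G {x} {y} w × All (_∉ S) (inner w))

-- a vertex set is represented by a duplicate-free list of vertices
IsKDMVSet : ∀ {V} (G : Graph V) (k : ℕ) (S : List V) → Set
IsKDMVSet G k S = Unique S × (∀ x y → x ∈ S → y ∈ S → SkVisible G S k x y)

IsMVSet : ∀ {V} (G : Graph V) (S : List V) → Set
IsMVSet G S = Unique S × (∀ x y → x ∈ S → y ∈ S → SVisible G S x y)

IsMaxCard : ∀ {V : Set} (P : List V → Set) (m : ℕ) → Set
IsMaxCard P m = (∃[ S ] (P S × length S ≡ m)) × (∀ S → P S → length S ≤ m)

MuK≡ : ∀ {V} (G : Graph V) (k m : ℕ) → Set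
MuK≡ G k m = IsMaxCard (IsKDMVSet G k) m

Mu≡ : ∀ {V} (G : Graph V) (m : ℕ) → Set
Mu≡ G m = IsMaxCard (IsMVSet G) m

{-# OPTIONS --safe #-}
-- Write p_i for the vertices of the path and call i the column of p_i and of the
-- copy of G attached to it.  Between vertices x, y in different columns every walk
-- has length at least |column x − column y| plus one for each of x, y lying in a
-- copy, and this is attained along the path; moreover every path vertex p_m between
-- x and y separates them, so it lies on every x,y-walk.  Hence no member p_m of a
-- k-distance mutual-visibility set S lies between two other members: S contains at
-- most two path vertices, and its copy vertices lie strictly between them, on one
-- side of the only one, in its column, or anywhere if there is none; the distance
-- bound confines them to fewer than k columns.  So |S| ≤ p + d·n with p ≤ 2, d < k
-- and p + d ≤ r, which yields the three upper bounds.  They are attained by p_0, p_k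
-- with the copies over columns 1, …, k − 1, by p_0 with the copies over columns
-- 1, …, r − 1, and by all copy vertices; as the diameter is r + 1, the last set is
-- also a mutual-visibility set of maximum size.

module Submission where

open import Defs
open import Data.Nat
  using (ℕ; zero; suc; >-nonZero; _≤_; _<_; _+_; _*_; _∸_; ∣_-_∣; z≤n; s≤s; s≤s⁻¹; _≟_; _≤?_; _<?_)
open import Data.Nat.Properties
open import Algebra.Properties.CommutativeSemigroup +-commutativeSemigroup
  using (x∙yz≈y∙xz; x∙yz≈xz∙y; xy∙z≈y∙xz)
open import Data.Fin using (Fin; toℕ; fromℕ<)
open import Data.Fin.Properties using (toℕ-injective; toℕ<n; toℕ-fromℕ<) renaming (_≟_ to _≟ᶠ_)
open import Data.Sum using (_⊎_; inj₁; inj₂; [_,_]′)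
open import Data.Product using (_×_; _,_; ∃; ∃-syntax; proj₁; proj₂)
open import Data.List
  using (List; []; _∷_; length; _++_; map; filter; allFin; applyUpTo; cartesianProductWith)
open import Data.List.Properties
  using (length-++; length-++-sucʳ; length-map; length-tabulate; length-applyUpTo)
open import Data.List.Relation.Unary.All as All using (All; []; _∷_)
open import Data.List.Relation.Unary.Any using (here; there; any?)
open import Data.List.Relation.Unary.Unique.Propositional using (Unique)
open import Data.List.Relation.Unary.AllPairs using ([]; _∷_)
open import Data.List.Membership.Propositional using (_∈_; _∉_; find; lose)
open import Data.List.Extrema.Nat using (argmin; argmin-all; f[argmin]≤f[xs])
open import Data.List.Membership.Propositional.Properties
  using (∈-++⁺ˡ; ∈-++⁺ʳ; ∈-++⁻; ∈-∃++; ∈-map⁺; ∈-map⁻; ∈-filter⁺; ∈-filter⁻; ∈-allFin;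
         ∈-applyUpTo⁺; ∈-applyUpTo⁻; ∈-cartesianProductWith⁺; ∈-cartesianProductWith⁻)
import Data.List.Relation.Unary.Unique.Propositional.Properties as Unique
open import Data.List.Relation.Binary.Subset.Propositional using (_⊆_)
open import Relation.Nullary using (¬_; ¬?; Dec; yes; no)
open import Relation.Nullary.Decidable using (_×-dec_)
open import Relation.Binary.PropositionalEquality
open import Relation.Binary.Definitions using (tri<; tri≈; tri>)
open import Data.Empty using (⊥-elim)
import Data.Sum.Properties as Sum
import Data.Product.Properties as Product

unique-⊆⇒length≤ : {A : Set} {xs ys : List A} → Unique xs → xs ⊆ ys → length xs ≤ length ys
unique-⊆⇒length≤ [] _ = z≤n
unique-⊆⇒length≤ {xs = x ∷ xs} (x∉xs ∷ xs!) xs⊆ys with ∈-∃++ (xs⊆ys (here refl))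
... | ys₁ , ys₂ , refl =
  subst (suc (length xs) ≤_) (sym (length-++-sucʳ ys₁ x ys₂))
    (s≤s (unique-⊆⇒length≤ xs! without-x))
  where
  without-x : xs ⊆ ys₁ ++ ys₂
  without-x v∈xs with ∈-++⁻ ys₁ (xs⊆ys (there v∈xs))
  ... | inj₁ v∈ys₁         = ∈-++⁺ˡ v∈ys₁
  ... | inj₂ (here refl)   = ⊥-elim (All.lookup x∉xs v∈xs refl)
  ... | inj₂ (there v∈ys₂) = ∈-++⁺ʳ ys₁ v∈ys₂

[]⊎∈ : {A : Set} (xs : List A) → xs ≡ [] ⊎ ∃[ x ] x ∈ xs
[]⊎∈ []      = inj₁ refl
[]⊎∈ (x ∷ _) = inj₂ (x , here refl)

∉[] : {A : Set} {x : A} → x ∉ []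
∉[] ()

∣n-1+n∣≡1 : ∀ n → ∣ n - suc n ∣ ≡ 1
∣n-1+n∣≡1 n = trans (m≤n⇒∣m-n∣≡n∸m (n≤1+n n)) (m+n∸n≡m 1 n)

∣-∣-adjacent : ∀ {a b} → b ≡ suc a ⊎ a ≡ suc b → ∣ a - b ∣ ≡ 1
∣-∣-adjacent {a} (inj₁ refl) = ∣n-1+n∣≡1 a
∣-∣-adjacent {_} {b} (inj₂ refl) = trans (∣-∣-comm (suc b) b) (∣n-1+n∣≡1 b)

∣a-c∣≤1+∣b-c∣ : ∀ {a b} c → b ≡ suc a ⊎ a ≡ suc b → ∣ a - c ∣ ≤ suc ∣ b - c ∣
∣a-c∣≤1+∣b-c∣ {a} {b} c adj =
  ≤-trans (∣-∣-triangle a b c) (≤-reflexive (cong (_+ ∣ b - c ∣) (∣-∣-adjacent adj)))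

d+a≡c⇒a<h+c : ∀ {a c d h} → d + a ≡ c → 0 < d + h → a < h + c
d+a≡c⇒a<h+c {a} {c} {d} {h} eq 0<d+h = begin-strict
  a           <⟨ m<n+m a 0<d+h ⟩
  d + h + a   ≡⟨ xy∙z≈y∙xz d h a ⟩
  h + (d + a) ≡⟨ cong (h +_) eq ⟩
  h + c       ∎
  where open ≤-Reasoning

m∸[m∸n]≤n : ∀ m n → m ∸ (m ∸ n) ≤ n
m∸[m∸n]≤n m n = m≤n+o⇒m∸n≤o m (m ∸ n) (subst (m ≤_) (+-comm n (m ∸ n)) (m≤n+m∸n m n))

data Side : Set where
  before at after : Side

side : ℕ → ℕ → Side
side m c with <-cmp c m
... | tri< _ _ _ = before
... | tri≈ _ _ _ = at
... | tri> _ _ _ = after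

side-suc : ∀ {m c} → c ≢ m → suc c ≢ m → side m c ≡ side m (suc c)
side-suc {m} {c} c≢m 1+c≢m with <-cmp c m | <-cmp (suc c) m
... | tri< _ _ _   | tri< _ _ _     = refl
... | tri> _ _ _   | tri> _ _ _     = refl
... | tri≈ _ c≡m _ | _              = ⊥-elim (c≢m c≡m)
... | _            | tri≈ _ 1+c≡m _ = ⊥-elim (1+c≢m 1+c≡m)
... | tri< c<m _ _ | tri> _ _ m<1+c = ⊥-elim (<⇒≱ m<1+c c<m)
... | tri> _ _ m<c | tri< 1+c<m _ _ = ⊥-elim (<-asym (m<n⇒m<1+n m<c) 1+c<m)

module _ {V : Set} {Γ : Graph V} where

  _∷ʳ_ : ∀ {x y z} → Walk Γ x y → Adj Γ y z → Walk Γ x z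
  []       ∷ʳ e = e ∷ []
  (e′ ∷ w) ∷ʳ e = e′ ∷ (w ∷ʳ e)

  reverse : ∀ {x y} → Walk Γ x y → Walk Γ y x
  reverse []      = []
  reverse (e ∷ w) = reverse w ∷ʳ symm Γ e

  len-∷ʳ : ∀ {x y z} (w : Walk Γ x y) (e : Adj Γ y z) → len (w ∷ʳ e) ≡ suc (len w)
  len-∷ʳ []       e = refl
  len-∷ʳ (e′ ∷ w) e = cong suc (len-∷ʳ w e)

  len-reverse : ∀ {x y} (w : Walk Γ x y) → len (reverse w) ≡ len w
  len-reverse []      = refl
  len-reverse (e ∷ w) = trans (len-∷ʳ (reverse w) (symm Γ e)) (cong suc (len-reverse w))

  ≢⇒0<len : ∀ {x y} → x ≢ y → (w : Walk Γ x y) → 0 < len w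
  ≢⇒0<len x≢y []      = ⊥-elim (x≢y refl)
  ≢⇒0<len x≢y (_ ∷ _) = s≤s z≤n

  inner-∷⁻ : ∀ {x y z v} (e : Adj Γ x y) (w : Walk Γ y z) →
             v ∈ inner (e ∷ w) → (v ≡ y × 0 < len w) ⊎ v ∈ inner w
  inner-∷⁻ e (_ ∷ w) (here refl) = inj₁ (refl , s≤s z≤n)
  inner-∷⁻ e (_ ∷ w) (there v∈)  = inj₂ v∈

  inner-∷⁺ : ∀ {x y z v} (e : Adj Γ x y) {w : Walk Γ y z} → v ∈ inner w → v ∈ inner (e ∷ w)
  inner-∷⁺ e {_ ∷ _} v∈ = there v∈

  next∈inner : ∀ {x y z} (e : Adj Γ x y) {w : Walk Γ y z} → 0 < len w → y ∈ inner (e ∷ w)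
  next∈inner e {_ ∷ _} _ = here refl

  inner-∷ʳ⁻ : ∀ {x y z v} (w : Walk Γ x y) (e : Adj Γ y z) →
              v ∈ inner (w ∷ʳ e) → v ∈ inner w ⊎ (v ≡ y × 0 < len w)
  inner-∷ʳ⁻ (e′ ∷ [])      e (here refl) = inj₂ (refl , s≤s z≤n)
  inner-∷ʳ⁻ (e′ ∷ e″ ∷ w)  e (here refl) = inj₁ (here refl)
  inner-∷ʳ⁻ (e′ ∷ e″ ∷ w)  e (there v∈) with inner-∷ʳ⁻ (e″ ∷ w) e v∈
  ... | inj₁ v∈w         = inj₁ (there v∈w)
  ... | inj₂ (refl , _)  = inj₂ (refl , s≤s z≤n)

  inner-reverse : ∀ {x y v} (w : Walk Γ x y) → v ∈ inner (reverse w) → v ∈ inner w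
  inner-reverse (e ∷ w) v∈ with inner-∷ʳ⁻ (reverse w) (symm Γ e) v∈
  ... | inj₁ v∈rev       = inner-∷⁺ e (inner-reverse w v∈rev)
  ... | inj₂ (refl , 0<) = next∈inner e (subst (0 <_) (len-reverse w) 0<)

  reverse-shortest : ∀ {x y} {w : Walk Γ x y} → IsShortest Γ w → IsShortest Γ (reverse w)
  reverse-shortest {w = w} shortest w′ =
    subst₂ _≤_ (sym (len-reverse w)) (len-reverse w′) (shortest (reverse w′))

  IsKDMVSet⇒IsMVSet : ∀ {k S} → IsKDMVSet Γ k S → IsMVSet Γ S
  IsKDMVSet⇒IsMVSet (S! , visible) = S! , λ x y x∈S y∈S →
    let (w , shortest , _ , avoids) = visible x y x∈S y∈S in w , shortest , avoids

  SkVisible-sym : ∀ {S k x y} → SkVisible Γ S k x y → SkVisible Γ S k y x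
  SkVisible-sym (w , shortest , len≤k , avoids) =
    reverse w , reverse-shortest shortest , subst (_≤ _) (sym (len-reverse w)) len≤k ,
    All.tabulate (λ v∈ → All.lookup avoids (inner-reverse w v∈))

module PathCorona {r n : ℕ} (G : Graph (Fin n)) where

  V : Set
  V = Fin r ⊎ (Fin r × Fin n)

  P⊙G : Graph V
  P⊙G = pathCorona r G

  pattern path i   = inj₁ i
  pattern copy i b = inj₂ (i , b)

  _≟ᵥ_ : (x y : V) → Dec (x ≡ y)
  _≟ᵥ_ = Sum.≡-dec _≟ᶠ_ (Product.≡-dec _≟ᶠ_ _≟ᶠ_)

  column : V → ℕ
  column (path i)   = toℕ i
  column (copy i _) = toℕ i

  depth : V → ℕ
  depth (path _)   = 0
  depth (copy _ _) = 1

  column<r : ∀ v → column v < r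
  column<r (path i)   = toℕ<n i
  column<r (copy i _) = toℕ<n i

  depth≤1 : ∀ v → depth v ≤ 1
  depth≤1 (path _)   = z≤n
  depth≤1 (copy _ _) = s≤s z≤n

  depth≤depth+len : ∀ {x y} (w : Walk P⊙G x y) → depth y ≤ depth x + len w
  depth≤depth+len {x} [] = m≤m+n (depth x) 0
  depth≤depth+len {x} {y} (_ ∷ w) = ≤-trans (depth≤1 y) (≤-trans (s≤s z≤n) (m≤n+m _ (depth x)))

  -- The distance from x to y, except when x and y lie in the same copy of G.
  δ : V → V → ℕ
  δ x y = depth x + depth y + ∣ column x - column y ∣

  δ-edge : ∀ {x z} y → Adj P⊙G x z → δ x y ≤ suc (δ z y)
  δ-edge {path a} {path a′} y adj = begin
    depth y + ∣ toℕ a - column y ∣       ≤⟨ +-monoʳ-≤ (depth y) (∣a-c∣≤1+∣b-c∣ (column y) adj) ⟩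
    depth y + suc ∣ toℕ a′ - column y ∣  ≡⟨ +-suc (depth y) _ ⟩
    suc (depth y + ∣ toℕ a′ - column y ∣) ∎
    where open ≤-Reasoning
  δ-edge {path _}   {copy _ _} y refl       = ≤-trans (n≤1+n _) (n≤1+n _)
  δ-edge {copy _ _} {path _}   y refl       = ≤-refl
  δ-edge {copy _ _} {copy _ _} y (refl , _) = n≤1+n _

  δ-edge-into-column : ∀ {x z y} → Adj P⊙G x z → (w : Walk P⊙G z y) →
                       column x ≢ column y → column z ≡ column y → δ x y ≤ suc (len w)
  δ-edge-into-column {path a} {path a′} {y} adj w _ z≡y = begin
    depth y + ∣ toℕ a - column y ∣ ≡⟨ cong (λ c → depth y + ∣ toℕ a - c ∣) (sym z≡y) ⟩
    depth y + ∣ toℕ a - toℕ a′ ∣  ≡⟨ cong (depth y +_) (∣-∣-adjacent adj) ⟩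
    depth y + 1                   ≡⟨ +-comm (depth y) 1 ⟩
    suc (depth y)                 ≤⟨ s≤s (depth≤depth+len w) ⟩
    suc (len w)                   ∎
    where open ≤-Reasoning
  δ-edge-into-column {path _}   {copy _ _} refl       w x≢y z≡y = ⊥-elim (x≢y z≡y)
  δ-edge-into-column {copy _ _} {path _}   refl       w x≢y z≡y = ⊥-elim (x≢y z≡y)
  δ-edge-into-column {copy _ _} {copy _ _} (refl , _) w x≢y z≡y = ⊥-elim (x≢y z≡y)

  δ≤len : ∀ {x y} (w : Walk P⊙G x y) → column x ≢ column y → δ x y ≤ len w
  δ≤len [] x≢y = ⊥-elim (x≢y refl)
  δ≤len {x} {y} (_∷_ {y = z} e w) x≢y with column z ≟ column y
  ... | yes z≡y = δ-edge-into-column {x} e w x≢y z≡y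
  ... | no  z≢y = ≤-trans (δ-edge {x} y e) (s≤s (δ≤len w z≢y))

  -- Path vertices as cut vertices

  -- path m lies between x and y: column x ≤ m ≤ column y, and path m is neither x nor y.
  record Between (m : Fin r) (x y : V) : Set where
    constructor _,_
    field
      after-x  : column x < depth x + toℕ m
      before-y : toℕ m < depth y + column y

  Between⇒≢ˡ : ∀ {m x y} → Between m x y → x ≢ path m
  Between⇒≢ˡ (m<m , _) refl = <-irrefl refl m<m

  Between⇒≢ʳ : ∀ {m x y} → Between m x y → y ≢ path m
  Between⇒≢ʳ (_ , m<m) refl = <-irrefl refl m<m

  -- Removing path m disconnects the columns before m, the copy of G at m and the
  -- columns after m from each other.
  side-edge : ∀ {m x z} → Adj P⊙G x z → x ≢ path m → z ≢ path m →
              side (toℕ m) (column x) ≡ side (toℕ m) (column z)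
  side-edge {m} {path a} {path a′} (inj₁ a′≡1+a) x≢m z≢m =
    trans (side-suc (path≢ x≢m) (subst (_≢ toℕ m) a′≡1+a (path≢ z≢m)))
          (cong (side (toℕ m)) (sym a′≡1+a))
    where
    path≢ : ∀ {a} → path a ≢ path m → toℕ a ≢ toℕ m
    path≢ ne a≡m = ne (cong path (toℕ-injective a≡m))
  side-edge {m} {path a} {path a′} (inj₂ a≡1+a′) x≢m z≢m =
    sym (side-edge {m} {path a′} {path a} (inj₁ a≡1+a′) z≢m x≢m)
  side-edge {x = path _}   {copy _ _} refl       _ _ = refl
  side-edge {x = copy _ _} {path _}   refl       _ _ = refl
  side-edge {x = copy _ _} {copy _ _} (refl , _) _ _ = refl

  side≢⇒∈inner : ∀ {m x y} (w : Walk P⊙G x y) → x ≢ path m → y ≢ path m →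
                 side (toℕ m) (column x) ≢ side (toℕ m) (column y) → path m ∈ inner w
  side≢⇒∈inner [] _ _ sides≢ = ⊥-elim (sides≢ refl)
  side≢⇒∈inner {m} {x} (_∷_ {y = z} e w) x≢m y≢m sides≢ with z ≟ᵥ path m
  ... | yes refl = next∈inner e (≢⇒0<len (λ m≡y → y≢m (sym m≡y)) w)
  ... | no  z≢m  = inner-∷⁺ e (side≢⇒∈inner w z≢m y≢m
                      (λ same → sides≢ (trans (side-edge {m} {x} e x≢m z≢m) same)))

  Between⇒sides≢ : ∀ {m x y} → column x < column y → Between m x y →
                   side (toℕ m) (column x) ≢ side (toℕ m) (column y)
  Between⇒sides≢ {m} {x} {y} x<y (x<m+ , m<y+)
    with <-cmp (column x) (toℕ m) | <-cmp (column y) (toℕ m)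
  ... | tri< _ _ _ | tri< y<m _ _ =
        ⊥-elim (<⇒≱ y<m (s≤s⁻¹ (≤-trans m<y+ (+-monoˡ-≤ (column y) (depth≤1 y)))))
  ... | tri< _ _ _ | tri≈ _ _ _   = λ ()
  ... | tri< _ _ _ | tri> _ _ _   = λ ()
  ... | tri≈ _ x≡m _ | tri< y<m _ _ = ⊥-elim (<-asym x<y (subst (column y <_) (sym x≡m) y<m))
  ... | tri≈ _ x≡m _ | tri≈ _ y≡m _ = ⊥-elim (<-irrefl (trans x≡m (sym y≡m)) x<y)
  ... | tri≈ _ _ _ | tri> _ _ _   = λ ()
  ... | tri> _ _ m<x | _ =
        ⊥-elim (<⇒≱ m<x (s≤s⁻¹ (≤-trans x<m+ (+-monoˡ-≤ (toℕ m) (depth≤1 x)))))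

  Between⇒∈inner : ∀ {m x y} (w : Walk P⊙G x y) → column x < column y → Between m x y →
                   path m ∈ inner w
  Between⇒∈inner w x<y btw =
    side≢⇒∈inner w (Between⇒≢ˡ btw) (Between⇒≢ʳ btw) (Between⇒sides≢ x<y btw)

  -- Geodesics

  InnerBetween : ∀ {x y} → Walk P⊙G x y → Set
  InnerBetween {x} {y} w = ∀ {v} → v ∈ inner w → ∃[ m ] (v ≡ path m × Between m x y)

  next-column< : ∀ (a : Fin r) y d → suc d + toℕ a ≡ column y → suc (toℕ a) < r
  next-column< a y d eq = ≤-<-trans (subst (suc (toℕ a) ≤_) eq (s≤s (m≤n+m (toℕ a) d))) (column<r y)

  next-column : ∀ (a : Fin r) y d → suc d + toℕ a ≡ column y → Fin r
  next-column a y d eq = fromℕ< (next-column< a y d eq)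

  toℕ-next-column : ∀ a y d eq → toℕ (next-column a y d eq) ≡ suc (toℕ a)
  toℕ-next-column a y d eq = toℕ-fromℕ< (next-column< a y d eq)

  next-column-eq : ∀ a y d eq → d + toℕ (next-column a y d eq) ≡ column y
  next-column-eq a y d eq = trans (cong (d +_) (toℕ-next-column a y d eq)) (trans (+-suc d (toℕ a)) eq)

  ascend : ∀ (a : Fin r) y d → d + toℕ a ≡ column y → Walk P⊙G (path a) y
  ascend a y (suc d) eq =
    inj₁ (toℕ-next-column a y d eq) ∷ ascend (next-column a y d eq) y d (next-column-eq a y d eq)
  ascend a (path c) zero eq with toℕ-injective {i = a} {j = c} eq
  ... | refl = []
  ascend a (copy c b) zero eq = toℕ-injective eq ∷ []

  len-ascend : ∀ a y d eq → len (ascend a y d eq) ≡ d + depth y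
  len-ascend a y (suc d) eq = cong suc (len-ascend (next-column a y d eq) y d (next-column-eq a y d eq))
  len-ascend a (path c) zero eq with toℕ-injective {i = a} {j = c} eq
  ... | refl = refl
  len-ascend a (copy c b) zero eq = refl

  inner-ascend : ∀ a y d eq → InnerBetween (ascend a y d eq)
  inner-ascend a y (suc d) eq {v} v∈ =
    [ next , later ]′ (inner-∷⁻ (inj₁ a′≡1+a) (ascend a′ y d eq′) v∈)
    where
    a′    = next-column a y d eq
    a′≡1+a = toℕ-next-column a y d eq
    eq′   = next-column-eq a y d eq
    a<a′ : toℕ a < toℕ a′
    a<a′ = ≤-reflexive (sym a′≡1+a)
    next : v ≡ path a′ × 0 < len (ascend a′ y d eq′) → ∃[ m ] (v ≡ path m × Between m (path a) y)
    next (refl , 0<len) =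
      a′ , refl , (a<a′ , d+a≡c⇒a<h+c eq′ (subst (0 <_) (len-ascend a′ y d eq′) 0<len))
    later : v ∈ inner (ascend a′ y d eq′) → ∃[ m ] (v ≡ path m × Between m (path a) y)
    later v∈rest with inner-ascend a′ y d eq′ v∈rest
    ... | m , refl , a′<m , m<y = m , refl , <-trans a<a′ a′<m , m<y
  inner-ascend a (path c) zero eq with toℕ-injective {i = a} {j = c} eq
  ... | refl = λ ()
  inner-ascend a (copy c b) zero eq = λ ()

  climb : ∀ x y d → d + column x ≡ column y → Walk P⊙G x y
  climb (path a)   y d eq = ascend a y d eq
  climb (copy a b) y d eq = refl ∷ ascend a y d eq

  len-climb : ∀ x y d eq → len (climb x y d eq) ≡ depth x + (d + depth y)
  len-climb (path a)   y d eq = len-ascend a y d eq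
  len-climb (copy a b) y d eq = cong suc (len-ascend a y d eq)

  inner-climb : ∀ x y d eq → InnerBetween (climb x y d eq)
  inner-climb (path a)   y d eq = inner-ascend a y d eq
  inner-climb (copy a b) y d eq v∈ with inner-∷⁻ {x = copy a b} refl (ascend a y d eq) v∈
  ... | inj₁ (refl , 0<len) =
        a , refl , (n<1+n (toℕ a) , d+a≡c⇒a<h+c eq (subst (0 <_) (len-ascend a y d eq) 0<len))
  ... | inj₂ v∈asc with inner-ascend a y d eq v∈asc
  ...   | m , refl , a<m , m<y = m , refl , m<n⇒m<1+n a<m , m<y

  Geodesic : V → V → Set
  Geodesic x y = ∃[ w ] (IsShortest P⊙G {x} {y} w × len w ≤ δ x y × InnerBetween w)

  same-column-geodesic : ∀ x y → column x ≡ column y → Geodesic x y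
  same-column-geodesic (path a) (path c) a≡c with toℕ-injective {i = a} {j = c} a≡c
  ... | refl = [] , (λ _ → z≤n) , z≤n , λ ()
  same-column-geodesic (path a) (copy c b) a≡c =
    (toℕ-injective a≡c ∷ []) , ≢⇒0<len (λ ()) , s≤s z≤n , λ ()
  same-column-geodesic (copy a b) (path c) a≡c =
    (toℕ-injective a≡c ∷ []) , ≢⇒0<len (λ ()) , s≤s z≤n , λ ()
  same-column-geodesic (copy a b) (copy c b′) a≡c with toℕ-injective {i = a} {j = c} a≡c
  ... | refl with b ≟ᶠ b′ | adj? G b b′
  ...   | yes refl | _      = [] , (λ _ → z≤n) , z≤n , λ ()
  ...   | no b≢b′  | yes ab = ((refl , ab) ∷ []) , ≢⇒0<len copy≢ , s≤s z≤n , λ ()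
    where
    copy≢ : copy a b ≢ copy a b′
    copy≢ refl = b≢b′ refl
  ...   | no b≢b′  | no ¬ab = via-path , shortest , s≤s (s≤s z≤n) , inner-via-path
    where
    via-path : Walk P⊙G (copy a b) (copy a b′)
    via-path = _∷_ {y = path a} refl (refl ∷ [])
    shortest : IsShortest P⊙G via-path
    shortest []              = ⊥-elim (b≢b′ refl)
    shortest ((_ , ab) ∷ []) = ⊥-elim (¬ab ab)
    shortest (_ ∷ _ ∷ _)     = s≤s (s≤s z≤n)
    inner-via-path : InnerBetween via-path
    inner-via-path (here refl) = a , refl , n<1+n (toℕ a) , n<1+n (toℕ a)

  geodesic : ∀ x y → column x ≤ column y → Geodesic x y
  geodesic x y x≤y with column x ≟ column y
  ... | yes x≡y = same-column-geodesic x y x≡y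
  ... | no  x≢y = climb x y d eq , (λ w′ → subst (_≤ len w′) (sym len≡δ) (δ≤len w′ x≢y)) ,
                  ≤-reflexive len≡δ , inner-climb x y d eq
    where
    d = column y ∸ column x
    eq : d + column x ≡ column y
    eq = m∸n+n≡m x≤y
    len≡δ : len (climb x y d eq) ≡ δ x y
    len≡δ = begin
      len (climb x y d eq)        ≡⟨ len-climb x y d eq ⟩
      depth x + (d + depth y)     ≡⟨ x∙yz≈xz∙y (depth x) d (depth y) ⟩
      depth x + depth y + d       ≡⟨ cong (depth x + depth y +_) (sym (m≤n⇒∣m-n∣≡n∸m x≤y)) ⟩
      δ x y                       ∎
      where open ≡-Reasoning

  δ≤band : ∀ {t k x y} → column x ≤ column y →
           depth x ≤ t + column x → depth y + (t + column y) ≤ k → δ x y ≤ k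
  δ≤band {t} {k} {x} {y} x≤y low high = begin
    depth x + depth y + ∣ column x - column y ∣ ≡⟨ cong (depth x + depth y +_) (m≤n⇒∣m-n∣≡n∸m x≤y) ⟩
    depth x + depth y + gap                     ≡⟨ xy∙z≈y∙xz (depth x) (depth y) gap ⟩
    depth y + (depth x + gap)                   ≤⟨ +-monoʳ-≤ (depth y) (+-monoˡ-≤ gap low) ⟩
    depth y + (t + column x + gap)              ≡⟨ cong (depth y +_) (+-assoc t (column x) gap) ⟩
    depth y + (t + (column x + gap))            ≡⟨ cong (λ c → depth y + (t + c)) (m+[n∸m]≡n x≤y) ⟩
    depth y + (t + column y)                    ≤⟨ high ⟩
    k                                           ∎
    where
    open ≤-Reasoning
    gap = column y ∸ column x

  module _ {S : List V} (t k : ℕ)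
           (low  : ∀ {x} → x ∈ S → depth x ≤ t + column x)
           (high : ∀ {x} → x ∈ S → depth x + (t + column x) ≤ k)
           (ends : ∀ {m} → path m ∈ S → t + toℕ m ≡ 0 ⊎ t + toℕ m ≡ k) where

    private
      forward : ∀ {x y} → x ∈ S → y ∈ S → column x ≤ column y → SkVisible P⊙G S k x y
      forward {x} {y} x∈S y∈S x≤y with geodesic x y x≤y
      ... | w , shortest , len≤δ , between =
            w , shortest , ≤-trans len≤δ (δ≤band x≤y (low x∈S) (high y∈S)) , All.tabulate avoid
        where
        avoid : ∀ {v} → v ∈ inner w → v ∉ S
        avoid v∈w v∈S with between v∈w
        ... | m , refl , x<m+ , m<y+ with ends v∈S
        ...   | inj₁ t+m≡0 = <-irrefl refl (begin-strict
          column x                  <⟨ x<m+ ⟩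
          depth x + toℕ m           ≤⟨ +-monoˡ-≤ (toℕ m) (low x∈S) ⟩
          t + column x + toℕ m      ≡⟨ xy∙z≈y∙xz t (column x) (toℕ m) ⟩
          column x + (t + toℕ m)    ≡⟨ cong (column x +_) t+m≡0 ⟩
          column x + 0              ≡⟨ +-identityʳ (column x) ⟩
          column x                  ∎)
          where open ≤-Reasoning
        ...   | inj₂ t+m≡k = <-irrefl refl (begin-strict
          k                         ≡⟨ sym t+m≡k ⟩
          t + toℕ m                 <⟨ +-monoʳ-< t m<y+ ⟩
          t + (depth y + column y)  ≡⟨ x∙yz≈y∙xz t (depth y) (column y) ⟩
          depth y + (t + column y)  ≤⟨ high y∈S ⟩
          k                         ∎)
          where open ≤-Reasoning

    band-visible : ∀ x y → x ∈ S → y ∈ S → SkVisible P⊙G S k x y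
    band-visible x y x∈S y∈S with ≤-total (column x) (column y)
    ... | inj₁ x≤y = forward x∈S y∈S x≤y
    ... | inj₂ y≤x = SkVisible-sym (forward y∈S x∈S y≤x)

  in-range? : ∀ lo hi (c : Fin r) → Dec (lo ≤ toℕ c × toℕ c < hi)
  in-range? lo hi c = (lo ≤? toℕ c) ×-dec (toℕ c <? hi)

  columns : ℕ → ℕ → List (Fin r)
  columns lo hi = filter (in-range? lo hi) (allFin r)

  ∈-columns⁺ : ∀ {lo hi c} → lo ≤ toℕ c → toℕ c < hi → c ∈ columns lo hi
  ∈-columns⁺ {lo} {hi} lo≤c c<hi = ∈-filter⁺ (in-range? lo hi) (∈-allFin _) (lo≤c , c<hi)

  ∈-columns⁻ : ∀ {lo hi c} → c ∈ columns lo hi → lo ≤ toℕ c × toℕ c < hi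
  ∈-columns⁻ {lo} {hi} c∈ = proj₂ (∈-filter⁻ (in-range? lo hi) {xs = allFin r} c∈)

  columns-unique : ∀ lo hi → Unique (columns lo hi)
  columns-unique lo hi = Unique.filter⁺ (in-range? lo hi) (Unique.allFin⁺ r)

  length-columns≤ : ∀ lo hi → length (columns lo hi) ≤ hi ∸ lo
  length-columns≤ lo hi =
    subst₂ _≤_ (length-map toℕ (columns lo hi)) (length-applyUpTo (lo +_) (hi ∸ lo))
      (unique-⊆⇒length≤ (Unique.map⁺ toℕ-injective (columns-unique lo hi)) into-range)
    where
    into-range : map toℕ (columns lo hi) ⊆ applyUpTo (lo +_) (hi ∸ lo)
    into-range m∈ with ∈-map⁻ toℕ m∈
    ... | c , c∈ , refl with ∈-columns⁻ c∈
    ...   | lo≤c , c<hi =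
            subst (_∈ applyUpTo (lo +_) (hi ∸ lo)) (m+[n∸m]≡n lo≤c)
                  (∈-applyUpTo⁺ (lo +_) (∸-monoˡ-< c<hi lo≤c))

  length-columns≤r∸lo : ∀ lo hi → length (columns lo hi) ≤ r ∸ lo
  length-columns≤r∸lo lo hi =
    ≤-trans (unique-⊆⇒length≤ (columns-unique lo hi)
                              (λ c∈ → ∈-columns⁺ (proj₁ (∈-columns⁻ c∈)) (toℕ<n _)))
            (length-columns≤ lo r)

  length-columns : ∀ lo hi → hi ≤ r → length (columns lo hi) ≡ hi ∸ lo
  length-columns lo hi hi≤r = ≤-antisym (length-columns≤ lo hi)
    (subst₂ _≤_ (length-applyUpTo (lo +_) (hi ∸ lo)) (length-map toℕ (columns lo hi))
      (unique-⊆⇒length≤ (Unique.applyUpTo⁺₁ (lo +_) (hi ∸ lo)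
                                             (λ i<j _ eq → <-irrefl (+-cancelˡ-≡ lo _ _ eq) i<j))
                        from-range))
    where
    from-range : applyUpTo (lo +_) (hi ∸ lo) ⊆ map toℕ (columns lo hi)
    from-range m∈ with ∈-applyUpTo⁻ (lo +_) m∈
    ... | i , i<hi-lo , refl =
          subst (_∈ map toℕ (columns lo hi)) (toℕ-fromℕ< m<r)
            (∈-map⁺ toℕ (∈-columns⁺ (subst (lo ≤_) (sym (toℕ-fromℕ< m<r)) (m≤m+n lo i))
                                     (subst (_< hi) (sym (toℕ-fromℕ< m<r)) m<hi)))
      where
      m<hi : lo + i < hi
      m<hi = subst (lo + i <_) (m+[n∸m]≡n lo≤hi) (+-monoʳ-< lo i<hi-lo)
        where
        lo≤hi : lo ≤ hi
        lo≤hi = <⇒≤ (m∸n≢0⇒n<m (λ hi∸lo≡0 → n≮0 (subst (i <_) hi∸lo≡0 i<hi-lo)))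
      m<r : lo + i < r
      m<r = <-≤-trans m<hi hi≤r

  copiesAt : List (Fin r) → List V
  copiesAt cs = cartesianProductWith (λ c b → copy c b) cs (allFin n)

  ∈-copiesAt⁺ : ∀ {c cs} b → c ∈ cs → copy c b ∈ copiesAt cs
  ∈-copiesAt⁺ b c∈ = ∈-cartesianProductWith⁺ (λ c b → copy c b) c∈ (∈-allFin b)

  ∈-copiesAt⁻ : ∀ {cs v} → v ∈ copiesAt cs → ∃[ c ] ∃[ b ] (c ∈ cs × v ≡ copy c b)
  ∈-copiesAt⁻ {cs} v∈ with ∈-cartesianProductWith⁻ (λ c b → copy c b) cs (allFin n) v∈
  ... | c , b , c∈ , _ , v≡ = c , b , c∈ , v≡

  path∉copiesAt : ∀ {a cs} → path a ∉ copiesAt cs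
  path∉copiesAt {cs = cs} p∈ with ∈-copiesAt⁻ {cs} p∈
  ... | _ , _ , _ , ()

  copiesAt-unique : ∀ {cs} → Unique cs → Unique (copiesAt cs)
  copiesAt-unique cs! =
    Unique.cartesianProductWith⁺ (λ c b → copy c b) (λ { refl → refl , refl }) cs! (Unique.allFin⁺ n)

  length-copiesAt : ∀ cs → length (copiesAt cs) ≡ length cs * n
  length-copiesAt []       = refl
  length-copiesAt (c ∷ cs) =
    trans (length-++ (map (λ b → copy c b) (allFin n)))
          (cong₂ _+_ (trans (length-map _ (allFin n)) (length-tabulate (λ b → b))) (length-copiesAt cs))

  -- Sizes of visibility sets

  -- Implied both by k-distance mutual visibility and, as the diameter is r + 1, by
  -- mutual visibility with k = r + 1.
  WalkVisible : ℕ → List V → Set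
  WalkVisible k S =
    ∀ {x y} → x ∈ S → y ∈ S → ∃ λ (w : Walk P⊙G x y) → len w ≤ k × All (_∉ S) (inner w)

  IsKDMVSet⇒WalkVisible : ∀ {k S} → IsKDMVSet P⊙G k S → WalkVisible k S
  IsKDMVSet⇒WalkVisible (_ , visible) x∈S y∈S with visible _ _ x∈S y∈S
  ... | w , _ , len≤k , avoids = w , len≤k , avoids

  δ≤1+r : ∀ x y → δ x y ≤ suc r
  δ≤1+r x y = begin
    depth x + depth y + ∣ column x - column y ∣ ≤⟨ +-monoˡ-≤ _ (+-mono-≤ (depth≤1 x) (depth≤1 y)) ⟩
    suc (suc ∣ column x - column y ∣)          ≤⟨ s≤s (≤-trans (s≤s (∣m-n∣≤m⊔n (column x) (column y)))
                                                             (⊔-lub (column<r x) (column<r y))) ⟩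
    suc r                                       ∎
    where open ≤-Reasoning

  walk≤1+r : ∀ x y → ∃ λ (w : Walk P⊙G x y) → len w ≤ suc r
  walk≤1+r x y with ≤-total (column x) (column y)
  ... | inj₁ x≤y with geodesic x y x≤y
  ...   | w , _ , len≤δ , _ = w , ≤-trans len≤δ (δ≤1+r x y)
  walk≤1+r x y | inj₂ y≤x with geodesic y x y≤x
  ...   | w , _ , len≤δ , _ =
          reverse w , subst (_≤ suc r) (sym (len-reverse w)) (≤-trans len≤δ (δ≤1+r y x))

  IsMVSet⇒WalkVisible : ∀ {S} → IsMVSet P⊙G S → WalkVisible (r + 1) S
  IsMVSet⇒WalkVisible (_ , visible) {x} {y} x∈S y∈S with visible _ _ x∈S y∈S
  ... | w , shortest , avoids = w , len≤r+1 , avoids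
    where
    len≤r+1 : len w ≤ r + 1
    len≤r+1 = ≤-trans (shortest (proj₁ (walk≤1+r x y)))
                      (≤-trans (proj₂ (walk≤1+r x y)) (≤-reflexive (+-comm 1 r)))

  record SizeBound (k s : ℕ) : Set where
    constructor size-bound
    field
      #paths #columns : ℕ
      #paths≤2        : #paths ≤ 2
      fits            : #paths + #columns ≤ r
      #columns<k      : #columns < k
      bounded         : s ≤ #paths + #columns * n

  module _ {k : ℕ} {S : List V} (S! : Unique S) (visible : WalkVisible k S)
           (2≤k : 2 ≤ k) (2≤r : 2 ≤ r) where

    private
      near : ∀ {x y} → x ∈ S → y ∈ S → column x ≢ column y → δ x y ≤ k
      near x∈S y∈S x≢y with visible x∈S y∈S
      ... | w , len≤k , _ = ≤-trans (δ≤len w x≢y) len≤k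

      unblocked : ∀ {x y m} → x ∈ S → y ∈ S → path m ∈ S → column x < column y → ¬ Between m x y
      unblocked x∈S y∈S m∈S x<y btw with visible x∈S y∈S
      ... | w , _ , avoids = All.lookup avoids (Between⇒∈inner w x<y btw) m∈S

      k∸1<k : k ∸ 1 < k
      k∸1<k = ∸-monoʳ-< (s≤s z≤n) (≤-trans (n≤1+n 1) 2≤k)

      covered : ∀ ps cs → length ps ≤ 2 → length ps + length cs ≤ r → length cs < k →
                S ⊆ ps ++ copiesAt cs → SizeBound k (length S)
      covered ps cs ps≤2 fits cs<k S⊆ = size-bound (length ps) (length cs) ps≤2 fits cs<k
        (≤-trans (unique-⊆⇒length≤ S! S⊆)
                 (≤-reflexive (trans (length-++ ps) (cong (length ps +_) (length-copiesAt cs)))))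

      copies-only : (∀ {v} → v ∈ S → depth v ≢ 0) → SizeBound k (length S)
      copies-only no-path with []⊎∈ S
      ... | inj₁ S≡[] =
            covered [] [] z≤n z≤n (≤-trans (s≤s z≤n) 2≤k) (λ v∈S → ⊥-elim (∉[] (subst (_ ∈_) S≡[] v∈S)))
      ... | inj₂ (u , u∈S) =
            from-leftmost (argmin column u S) (argmin-all column u∈S (All.tabulate (λ v∈S → v∈S)))
                          (All.lookup (f[argmin]≤f[xs] u S))
        where
        from-leftmost : ∀ x → x ∈ S → (∀ {v} → v ∈ S → column x ≤ column v) →
                        SizeBound k (length S)
        from-leftmost (path _) x∈S _ = ⊥-elim (no-path x∈S refl)
        from-leftmost (copy a _) x∈S leftmost =
          covered [] cs z≤n (≤-trans (length-columns≤r∸lo _ _) (m∸n≤m r (toℕ a)))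
                  (≤-<-trans (subst (length cs ≤_) (m+n∸m≡n (toℕ a) (k ∸ 1)) (length-columns≤ _ _)) k∸1<k)
                  within
          where
          cs = columns (toℕ a) (toℕ a + (k ∸ 1))
          within : S ⊆ copiesAt cs
          within {path _} v∈S = ⊥-elim (no-path v∈S refl)
          within {copy c b} v∈S = ∈-copiesAt⁺ b (∈-columns⁺ (leftmost v∈S) c<a+k∸1)
            where
            gap<k∸1 : ∣ toℕ a - toℕ c ∣ < k ∸ 1
            gap<k∸1 with toℕ a ≟ toℕ c
            ... | yes a≡c = subst (λ g → g < k ∸ 1) (sym (m≡n⇒∣m-n∣≡0 a≡c)) (∸-monoˡ-≤ 1 2≤k)
            ... | no  a≢c = ∸-monoˡ-≤ 1 (near x∈S v∈S a≢c)
            c<a+k∸1 : toℕ c < toℕ a + (k ∸ 1)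
            c<a+k∸1 = ≤-<-trans (m≤n+∣n-m∣ (toℕ c) (toℕ a)) (+-monoʳ-< (toℕ a) gap<k∸1)

      two-paths : ∀ {i j} → path i ∈ S → path j ∈ S → toℕ i < toℕ j → SizeBound k (length S)
      two-paths {i} {j} i∈S j∈S i<j = covered (path i ∷ path j ∷ []) cs ≤-refl fits cs<k between-ends
        where
        cs = columns (suc (toℕ i)) (toℕ j)
        j∸i≡ : toℕ j ∸ toℕ i ≡ suc (toℕ j ∸ suc (toℕ i))
        j∸i≡ = +-∸-assoc 1 i<j
        j∸i≤k : toℕ j ∸ toℕ i ≤ k
        j∸i≤k = subst (_≤ k) (m≤n⇒∣m-n∣≡n∸m (<⇒≤ i<j)) (near i∈S j∈S (<⇒≢ i<j))
        cs<k : length cs < k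
        cs<k = ≤-trans (s≤s (length-columns≤ _ _)) (subst (_≤ k) j∸i≡ j∸i≤k)
        fits : 2 + length cs ≤ r
        fits = ≤-trans (s≤s (s≤s (length-columns≤ _ _)))
                       (≤-trans (≤-reflexive (cong suc (sym j∸i≡)))
                                (≤-trans (s≤s (m∸n≤m (toℕ j) (toℕ i))) (toℕ<n j)))
        between-ends : S ⊆ path i ∷ path j ∷ copiesAt cs
        between-ends {path m} m∈S with <-cmp (toℕ m) (toℕ i) | <-cmp (toℕ m) (toℕ j)
        ... | tri< m<i _ _ | _ = ⊥-elim (unblocked m∈S j∈S i∈S (<-trans m<i i<j) (m<i , i<j))
        ... | tri≈ _ m≡i _ | _ = here (cong path (toℕ-injective m≡i))
        ... | tri> _ _ i<m | tri< m<j _ _ = ⊥-elim (unblocked i∈S j∈S m∈S i<j (i<m , m<j))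
        ... | tri> _ _ _   | tri≈ _ m≡j _ = there (here (cong path (toℕ-injective m≡j)))
        ... | tri> _ _ i<m | tri> _ _ j<m = ⊥-elim (unblocked i∈S m∈S j∈S i<m (i<j , j<m))
        between-ends {copy c b} c∈S with toℕ c ≤? toℕ i | toℕ j ≤? toℕ c
        ... | yes c≤i | _ = ⊥-elim (unblocked c∈S j∈S i∈S (≤-<-trans c≤i i<j) (s≤s c≤i , i<j))
        ... | no  _   | yes j≤c = ⊥-elim (unblocked i∈S c∈S j∈S (<-≤-trans i<j j≤c) (i<j , s≤s j≤c))
        ... | no  c≰i | no j≰c = there (there (∈-copiesAt⁺ b (∈-columns⁺ (≰⇒> c≰i) (≰⇒> j≰c))))

      module _ {i : Fin r} (i∈S : path i ∈ S) (only : ∀ {j} → path j ∈ S → j ≡ i) where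

        paths-only-i : ∀ {j} {vs : List V} → path j ∈ S → path j ∈ path i ∷ vs
        paths-only-i j∈S = here (cong path (only j∈S))

        copies-left : ∀ {c₀ b₀} → copy c₀ b₀ ∈ S → toℕ c₀ < toℕ i → SizeBound k (length S)
        copies-left c₀∈S c₀<i = covered (path i ∷ []) cs (s≤s z≤n) fits cs<k left-of-i
          where
          lo = toℕ i ∸ (k ∸ 1)
          cs = columns lo (toℕ i)
          fits : 1 + length cs ≤ r
          fits = ≤-trans (s≤s (≤-trans (length-columns≤ lo (toℕ i)) (m∸n≤m (toℕ i) lo))) (toℕ<n i)
          cs<k : length cs < k
          cs<k = ≤-<-trans (≤-trans (length-columns≤ lo (toℕ i)) (m∸[m∸n]≤n (toℕ i) (k ∸ 1))) k∸1<k
          left-of-i : S ⊆ path i ∷ copiesAt cs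
          left-of-i {path j} j∈S = paths-only-i j∈S
          left-of-i {copy c b} c∈S with toℕ i ≤? toℕ c
          ... | yes i≤c = ⊥-elim (unblocked c₀∈S c∈S i∈S (<-≤-trans c₀<i i≤c)
                                            (m<n⇒m<1+n c₀<i , s≤s i≤c))
          ... | no  i≰c = there (∈-copiesAt⁺ b (∈-columns⁺ lo≤c c<i))
            where
            c<i = ≰⇒> i≰c
            gap≤k∸1 : ∣ toℕ c - toℕ i ∣ ≤ k ∸ 1
            gap≤k∸1 = ∸-monoˡ-≤ 1 (near c∈S i∈S (<⇒≢ c<i))
            lo≤c : lo ≤ toℕ c
            lo≤c = m≤n+o⇒m∸n≤o (toℕ i) (k ∸ 1)
                     (≤-trans (m≤n+∣n-m∣ (toℕ i) (toℕ c))
                              (≤-trans (+-monoʳ-≤ (toℕ c) gap≤k∸1) (≤-reflexive (+-comm (toℕ c) (k ∸ 1)))))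

        copies-at : ∀ {c₀ b₀} → copy c₀ b₀ ∈ S → toℕ c₀ ≡ toℕ i →
                    (∀ {c b} → copy c b ∈ S → toℕ i ≤ toℕ c) → SizeBound k (length S)
        copies-at c₀∈S c₀≡i no-left = covered (path i ∷ []) cs (s≤s z≤n) fits cs<k at-i
          where
          cs = columns (toℕ i) (suc (toℕ i))
          cs≤1 : length cs ≤ 1
          cs≤1 = subst (length cs ≤_) (m+n∸n≡m 1 (toℕ i)) (length-columns≤ _ _)
          fits : 1 + length cs ≤ r
          fits = ≤-trans (s≤s cs≤1) 2≤r
          cs<k : length cs < k
          cs<k = ≤-trans (s≤s cs≤1) 2≤k
          at-i : S ⊆ path i ∷ copiesAt cs
          at-i {path j} j∈S = paths-only-i j∈S
          at-i {copy c b} c∈S with <-cmp (toℕ i) (toℕ c)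
          ... | tri< i<c _ _ = ⊥-elim (unblocked c₀∈S c∈S i∈S (subst (_< toℕ c) (sym c₀≡i) i<c)
                                                 (s≤s (≤-reflexive c₀≡i) , s≤s (<⇒≤ i<c)))
          ... | tri≈ _ i≡c _ =
                there (∈-copiesAt⁺ b (∈-columns⁺ (≤-reflexive i≡c) (s≤s (≤-reflexive (sym i≡c)))))
          ... | tri> _ _ c<i = ⊥-elim (<⇒≱ c<i (no-left c∈S))

        copies-right : (∀ {c b} → copy c b ∈ S → toℕ i < toℕ c) → SizeBound k (length S)
        copies-right right = covered (path i ∷ []) cs (s≤s z≤n) fits cs<k right-of-i
          where
          cs = columns (suc (toℕ i)) (suc (toℕ i) + (k ∸ 1))
          fits : 1 + length cs ≤ r
          fits = ≤-trans (s≤s (length-columns≤r∸lo _ _)) (∸-monoʳ-< (s≤s z≤n) (toℕ<n i))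
          cs<k : length cs < k
          cs<k = ≤-<-trans (subst (length cs ≤_) (m+n∸m≡n (suc (toℕ i)) (k ∸ 1)) (length-columns≤ _ _))
                           k∸1<k
          right-of-i : S ⊆ path i ∷ copiesAt cs
          right-of-i {path j} j∈S = paths-only-i j∈S
          right-of-i {copy c b} c∈S = there (∈-copiesAt⁺ b (∈-columns⁺ i<c (s≤s c≤i+k∸1)))
            where
            i<c = right c∈S
            gap≤k∸1 : ∣ toℕ i - toℕ c ∣ ≤ k ∸ 1
            gap≤k∸1 = ∸-monoˡ-≤ 1 (near i∈S c∈S (<⇒≢ i<c))
            c≤i+k∸1 : toℕ c ≤ toℕ i + (k ∸ 1)
            c≤i+k∸1 = ≤-trans (m≤n+∣n-m∣ (toℕ c) (toℕ i)) (+-monoʳ-≤ (toℕ i) gap≤k∸1)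

        one-path : SizeBound k (length S)
        one-path with any? (λ v → (depth v ≟ 1) ×-dec (column v <? toℕ i)) S
        ... | yes copy-left with find copy-left
        ...   | path _ , _ , () , _
        ...   | copy _ _ , c₀∈S , _ , c₀<i = copies-left c₀∈S c₀<i
        one-path | no ¬left with any? (λ v → (depth v ≟ 1) ×-dec (column v ≟ toℕ i)) S
        ...   | yes copy-at with find copy-at
        ...     | path _ , _ , () , _
        ...     | copy _ _ , c₀∈S , _ , c₀≡i = copies-at c₀∈S c₀≡i not-left
          where
          not-left : ∀ {c b} → copy c b ∈ S → toℕ i ≤ toℕ c
          not-left c∈S = ≮⇒≥ (λ c<i → ¬left (lose c∈S (refl , c<i)))
        one-path | no ¬left | no ¬at = copies-right right
          where
          right : ∀ {c b} → copy c b ∈ S → toℕ i < toℕ c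
          right {c} c∈S with <-cmp (toℕ i) (toℕ c)
          ... | tri< i<c _ _ = i<c
          ... | tri≈ _ i≡c _ = ⊥-elim (¬at (lose c∈S (refl , sym i≡c)))
          ... | tri> _ _ c<i = ⊥-elim (¬left (lose c∈S (refl , c<i)))

    WalkVisible⇒SizeBound : SizeBound k (length S)
    WalkVisible⇒SizeBound with any? (λ v → depth v ≟ 0) S
    ... | no ¬path = copies-only (λ v∈S d≡0 → ¬path (lose v∈S d≡0))
    ... | yes some with find some
    ...   | copy _ _ , _ , ()
    ...   | path i , i∈S , _ with any? (λ v → (depth v ≟ 0) ×-dec ¬? (v ≟ᵥ path i)) S
    ...     | yes other with find other
    ...       | copy _ _ , _ , () , _
    ...       | path j , j∈S , _ , j≢i with <-cmp (toℕ i) (toℕ j)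
    ...         | tri< i<j _ _ = two-paths i∈S j∈S i<j
    ...         | tri≈ _ i≡j _ = ⊥-elim (j≢i (cong path (sym (toℕ-injective i≡j))))
    ...         | tri> _ _ j<i = two-paths j∈S i∈S j<i
    WalkVisible⇒SizeBound | yes _ | path i , i∈S , _ | no ¬other = one-path i∈S only
      where
      only : ∀ {j} → path j ∈ S → j ≡ i
      only {j} j∈S with j ≟ᶠ i
      ... | yes j≡i = j≡i
      ... | no  j≢i = ⊥-elim (¬other (lose j∈S (refl , λ { refl → j≢i refl })))

  module Extremal {o : Fin r} (o≡0 : toℕ o ≡ 0) where

    private
      copies-in-band : ∀ {hi v} → v ∈ copiesAt (columns 1 hi) →
                       depth v ≤ column v × depth v + column v ≤ hi
      copies-in-band {hi} v∈ with ∈-copiesAt⁻ {columns 1 hi} v∈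
      ... | _ , _ , c∈ , refl = ∈-columns⁻ c∈

      path∉copies : ∀ {a hi} → All (path a ≢_) (copiesAt (columns 1 hi))
      path∉copies {hi = hi} =
        All.tabulate (λ v∈ a≡v → path∉copiesAt {cs = columns 1 hi} (subst (_∈ _) (sym a≡v) v∈))

    two-ended : ∀ k → k < r → List V
    two-ended k k<r = path o ∷ path (fromℕ< k<r) ∷ copiesAt (columns 1 k)

    two-ended-kdmv : ∀ k (k<r : k < r) → 1 ≤ k → IsKDMVSet P⊙G k (two-ended k k<r)
    two-ended-kdmv k k<r 1≤k =
      ((o≢k ∷ path∉copies) ∷ path∉copies ∷ copiesAt-unique (columns-unique 1 k)) ,
      band-visible 0 k low high ends
      where
      o≢k : path o ≢ path (fromℕ< k<r)
      o≢k o≡k = <⇒≢ 1≤k (trans (sym o≡0) (trans (cong column o≡k) (toℕ-fromℕ< k<r)))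
      low : ∀ {x} → x ∈ two-ended k k<r → depth x ≤ 0 + column x
      low (here refl)          = z≤n
      low (there (here refl))  = z≤n
      low (there (there v∈))   = proj₁ (copies-in-band v∈)
      high : ∀ {x} → x ∈ two-ended k k<r → depth x + (0 + column x) ≤ k
      high (here refl)         = subst (_≤ k) (sym o≡0) z≤n
      high (there (here refl)) = ≤-reflexive (toℕ-fromℕ< k<r)
      high (there (there v∈))  = proj₂ (copies-in-band v∈)
      ends : ∀ {m} → path m ∈ two-ended k k<r → 0 + toℕ m ≡ 0 ⊎ 0 + toℕ m ≡ k
      ends (here refl)         = inj₁ o≡0
      ends (there (here refl)) = inj₂ (toℕ-fromℕ< k<r)
      ends (there (there p∈))  = ⊥-elim (path∉copiesAt {cs = columns 1 k} p∈)

    length-two-ended : ∀ k (k<r : k < r) → length (two-ended k k<r) ≡ (k ∸ 1) * n + 2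
    length-two-ended k k<r =
      trans (cong (2 +_) (trans (length-copiesAt (columns 1 k))
                                (cong (_* n) (length-columns 1 k (<⇒≤ k<r)))))
            (+-comm 2 _)

    one-ended : List V
    one-ended = path o ∷ copiesAt (columns 1 r)

    one-ended-kdmv : IsKDMVSet P⊙G r one-ended
    one-ended-kdmv = (path∉copies ∷ copiesAt-unique (columns-unique 1 r)) , band-visible 0 r low high ends
      where
      low : ∀ {x} → x ∈ one-ended → depth x ≤ 0 + column x
      low (here refl) = z≤n
      low (there v∈)  = proj₁ (copies-in-band v∈)
      high : ∀ {x} → x ∈ one-ended → depth x + (0 + column x) ≤ r
      high (here refl) = subst (_≤ r) (sym o≡0) z≤n
      high (there v∈)  = proj₂ (copies-in-band v∈)
      ends : ∀ {m} → path m ∈ one-ended → 0 + toℕ m ≡ 0 ⊎ 0 + toℕ m ≡ r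
      ends (here refl) = inj₁ o≡0
      ends (there p∈)  = ⊥-elim (path∉copiesAt {cs = columns 1 r} p∈)

    length-one-ended : length one-ended ≡ (r ∸ 1) * n + 1
    length-one-ended =
      trans (cong suc (trans (length-copiesAt (columns 1 r)) (cong (_* n) (length-columns 1 r ≤-refl))))
            (+-comm 1 _)

  all-copies : List V
  all-copies = copiesAt (columns 0 r)

  all-copies-kdmv : IsKDMVSet P⊙G (r + 1) all-copies
  all-copies-kdmv = copiesAt-unique (columns-unique 0 r) , band-visible 1 (r + 1) low high ends
    where
    low : ∀ {x} → x ∈ all-copies → depth x ≤ 1 + column x
    low v∈ with ∈-copiesAt⁻ {columns 0 r} v∈
    ... | _ , _ , _ , refl = s≤s z≤n
    high : ∀ {x} → x ∈ all-copies → depth x + (1 + column x) ≤ r + 1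
    high v∈ with ∈-copiesAt⁻ {columns 0 r} v∈
    ... | c , _ , _ , refl = ≤-trans (s≤s (toℕ<n c)) (≤-reflexive (+-comm 1 r))
    ends : ∀ {m} → path m ∈ all-copies → 1 + toℕ m ≡ 0 ⊎ 1 + toℕ m ≡ r + 1
    ends p∈ = ⊥-elim (path∉copiesAt {cs = columns 0 r} p∈)

  length-all-copies : length all-copies ≡ r * n
  length-all-copies = trans (length-copiesAt (columns 0 r)) (cong (_* n) (length-columns 0 r ≤-refl))

  SizeBound⇒≤[k∸1]n+2 : ∀ {k s} → SizeBound k s → s ≤ (k ∸ 1) * n + 2
  SizeBound⇒≤[k∸1]n+2 (size-bound p d p≤2 _ d<k s≤) =
    ≤-trans s≤ (≤-trans (+-mono-≤ p≤2 (*-monoˡ-≤ n (∸-monoˡ-≤ 1 d<k))) (≤-reflexive (+-comm 2 _)))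

  SizeBound⇒≤[r∸1]n+1 : 1 ≤ n → ∀ {s} → SizeBound r s → s ≤ (r ∸ 1) * n + 1
  SizeBound⇒≤[r∸1]n+1 _ (size-bound zero d _ _ d<r s≤) =
    ≤-trans s≤ (≤-trans (*-monoˡ-≤ n (∸-monoˡ-≤ 1 d<r)) (m≤m+n _ 1))
  SizeBound⇒≤[r∸1]n+1 1≤n (size-bound (suc p) d _ fits _ s≤) = ≤-trans s≤ (begin
    suc (p + d * n)         ≤⟨ s≤s (+-monoˡ-≤ (d * n) (m≤m*n p n ⦃ >-nonZero 1≤n ⦄)) ⟩
    suc (p * n + d * n)     ≡⟨ cong suc (sym (*-distribʳ-+ n p d)) ⟩
    suc ((p + d) * n)       ≤⟨ s≤s (*-monoˡ-≤ n (∸-monoˡ-≤ 1 fits)) ⟩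
    suc ((r ∸ 1) * n)       ≡⟨ +-comm 1 _ ⟩
    (r ∸ 1) * n + 1         ∎)
    where open ≤-Reasoning

  SizeBound⇒≤rn : 1 ≤ n → ∀ {k s} → SizeBound k s → s ≤ r * n
  SizeBound⇒≤rn 1≤n (size-bound p d _ fits _ s≤) = ≤-trans s≤ (begin
    p + d * n        ≤⟨ +-monoˡ-≤ (d * n) (m≤m*n p n ⦃ >-nonZero 1≤n ⦄) ⟩
    p * n + d * n    ≡⟨ sym (*-distribʳ-+ n p d) ⟩
    (p + d) * n      ≤⟨ *-monoˡ-≤ n fits ⟩
    r * n            ∎)
    where open ≤-Reasoning

theorem4p6 : (n r : ℕ) (G : Graph (Fin n)) → 2 ≤ n → 3 ≤ r →
    ((k : ℕ) → 2 ≤ k → k ≤ r ∸ 1 → MuK≡ (pathCorona r G) k ((k ∸ 1) * n + 2))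
    × MuK≡ (pathCorona r G) r ((r ∸ 1) * n + 1)
    × MuK≡ (pathCorona r G) (r + 1) (r * n)
    × Mu≡ (pathCorona r G) (r * n)
theorem4p6 n r G 2≤n 3≤r = part₁ , part₂ , part₃ , part₄
  where
  open PathCorona {r} {n} G
  1≤n : 1 ≤ n
  1≤n = ≤-trans (s≤s z≤n) 2≤n
  2≤r : 2 ≤ r
  2≤r = ≤-trans (n≤1+n 2) 3≤r
  0<r : 0 < r
  0<r = ≤-trans (s≤s z≤n) 3≤r
  2≤r+1 : 2 ≤ r + 1
  2≤r+1 = ≤-trans 2≤r (m≤m+n r 1)
  open Extremal (toℕ-fromℕ< 0<r)

  bound : ∀ {k S} → 2 ≤ k → IsKDMVSet P⊙G k S → SizeBound k (length S)
  bound 2≤k kd = WalkVisible⇒SizeBound (proj₁ kd) (IsKDMVSet⇒WalkVisible kd) 2≤k 2≤r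

  part₁ : (k : ℕ) → 2 ≤ k → k ≤ r ∸ 1 → MuK≡ P⊙G k ((k ∸ 1) * n + 2)
  part₁ k 2≤k k≤r∸1 =
    (two-ended k k<r , two-ended-kdmv k k<r (≤-trans (s≤s z≤n) 2≤k) , length-two-ended k k<r) ,
    λ S kd → SizeBound⇒≤[k∸1]n+2 (bound 2≤k kd)
    where
    k<r : k < r
    k<r = ≤-<-trans k≤r∸1 (∸-monoʳ-< (s≤s z≤n) 0<r)

  part₂ : MuK≡ P⊙G r ((r ∸ 1) * n + 1)
  part₂ = (one-ended , one-ended-kdmv , length-one-ended) ,
          λ S kd → SizeBound⇒≤[r∸1]n+1 1≤n (bound 2≤r kd)

  part₃ : MuK≡ P⊙G (r + 1) (r * n)
  part₃ = (all-copies , all-copies-kdmv , length-all-copies) ,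
          λ S kd → SizeBound⇒≤rn 1≤n (bound 2≤r+1 kd)

  part₄ : Mu≡ P⊙G (r * n)
  part₄ = (all-copies , IsKDMVSet⇒IsMVSet all-copies-kdmv , length-all-copies) ,
          λ S mv → SizeBound⇒≤rn 1≤n (WalkVisible⇒SizeBound (proj₁ mv) (IsMVSet⇒WalkVisible mv) 2≤r+1 2≤r)
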